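{- The first difference sequence $\Delta(\mathbf{t}_{3/2})$ equals the Toeplitz word $\mathcal{T}(01?0?10??)$; in particular it is a $(9,4)$-Toeplitz word.
   Context: Let $\mathbf{t}_{3/2}=(t_n)_{n\ge0}\in\{0,1\}^{\mathbb{N}}$ be the unique binary sequence with $t_0=0$ such that $t_{3n}=t_{3n+1}=t_{2n}$ and $t_{3n+2}=1-t_{2n+1}$ for all $n\ge0$, and $\Delta(\mathbf{t}_{3/2})=(t_{n+1}-t_n\bmod 2)_{n\ge0}$. Toeplitz words: let $A$ be an alphabet, $?\notin A$ a symbol, and $w\in A(A\cup\{?\})^*$ a pattern. Set $\mathcal{T}_0(w)=?^\omega$ and $\mathcal{T}_{i+1}(w)=F_w(\mathcal{T}_i(w))$, where for $\mathbf{u}\in(A\cup\{?\})^{\mathbb{N}}$, $F_w(\mathbf{u})$ is obtained by replacing the successive occurrences of $?$ in $\mathbf{u}$ by the successive letters of $w^\omega=www\cdots$. The Toeplitz word $\mathcal{T}(w)=\lim_{i}\mathcal{T}_i(w)$; if $|w|=p$ and $w$ has $q$ occurrences of $?$, it is called a $(p,q)$-Toeplitz word. -}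

module Defs where

open import Data.Nat using (ℕ; zero; suc; _+_; _*_; _%_; _≤_)
open import Data.Bool using (Bool; true; false; not; _xor_)
open import Data.Maybe using (Maybe; just; nothing)
open import Data.List using (List; []; _∷_; length)
open import Data.Fin using (Fin)
open import Data.List using (lookup)
open import Data.Nat.DivMod using (_mod_)
open import Data.Product using (∃; _×_)
open import Relation.Binary.PropositionalEquality using (_≡_)

-- Binary letters: 0 = false, 1 = true.  A partial word over A ∪ {?}
-- is a sequence ℕ → Maybe A, where nothing plays the role of '?'.

-- The defining recurrences of t_{3/2} (the sequence is the unique one satisfying them).
IsT32 : (ℕ → Bool) → Set
IsT32 t = (t 0 ≡ false)
        × (∀ n → t (3 * n) ≡ t (2 * n))
        × (∀ n → t (3 * n + 1) ≡ t (2 * n))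
        × (∀ n → t (3 * n + 2) ≡ not (t (2 * n + 1)))

Δ : (ℕ → Bool) → ℕ → Bool
Δ t n = t (suc n) xor t n

holesBefore : {A : Set} → (ℕ → Maybe A) → ℕ → ℕ
holesBefore u zero = zero
holesBefore u (suc n) with u n
... | nothing = suc (holesBefore u n)
... | just _  = holesBefore u n

-- A pattern w ∈ A (A ∪ {?})* is given as its first letter a and the rest.
pattern-word : {A : Set} → A → List (Maybe A) → List (Maybe A)
pattern-word a rest = just a ∷ rest

periodic : {A : Set} → A → List (Maybe A) → ℕ → Maybe A
periodic a rest k = lookup (pattern-word a rest) (k mod length (pattern-word a rest))

F : {A : Set} → A → List (Maybe A) → (ℕ → Maybe A) → ℕ → Maybe A
F a rest u n with u n
... | nothing = periodic a rest (holesBefore u n)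
... | just b  = just b

𝒯 : {A : Set} → A → List (Maybe A) → ℕ → ℕ → Maybe A
𝒯 a rest zero    = λ _ → nothing
𝒯 a rest (suc i) = F a rest (𝒯 a rest i)

-- 𝒯(w) = lim_i 𝒯_i(w) equals x (limit in the product topology, i.e. pointwise
-- eventual stabilisation at a letter of A).
IsToeplitzLimit : {A : Set} → A → List (Maybe A) → (ℕ → A) → Set
IsToeplitzLimit a rest x = ∀ n → ∃ λ i → ∀ j → i ≤ j → 𝒯 a rest j n ≡ just (x n)

countHoles : {A : Set} → List (Maybe A) → ℕ
countHoles [] = zero
countHoles (nothing ∷ w) = suc (countHoles w)
countHoles (just _ ∷ w) = countHoles w

-- The pattern 01?0?10??  (first letter 0, then the rest).
w-rest : List (Maybe Bool)
w-rest = just true ∷ nothing ∷ just false ∷ nothing ∷ just true ∷ just false ∷ nothing ∷ nothing ∷ []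

-- Write u ◃ v for the partial word obtained by filling the holes of u, in order, with the successive
-- symbols of v; thus F_w u = u ◃ w^ω.  Hole filling is associative, so 𝒯_{i+1}(w) = w^ω ◃ 𝒯_i(w),
-- and every x with w^ω ◃ x = x is the Toeplitz word of w: at a letter of w^ω, 𝒯_i is correct from
-- i = 1 on, and at a hole n it is 𝒯_{i-1} read at position holesBefore w^ω n < n, so induction on n
-- applies.  For w = 01?0?10?? that fixed-point equation reads Δ(9k+r) = w_r at the letters and
-- Δ(9k+r) = Δ(4k+j) at the j-th hole, which follows by applying twice the recurrences
-- Δ(3n) = 0, Δ(3n+1) = ¬Δ(2n), Δ(3n+2) = ¬Δ(2n+1) inherited from t_{3/2}.
module Submission where

open import Defs
open import Data.Bool using (Bool; false; not; _xor_)
open import Data.Bool.Properties using (xor-same; not-distribˡ-xor; not-distribʳ-xor; not-involutive)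
open import Data.Fin.Properties using (fromℕ<-cong)
open import Data.List using (List; []; _∷_; length; lookup)
open import Data.Maybe using (Maybe; just; nothing; _<∣>_)
open import Data.Maybe.Properties using (<∣>-assoc; <∣>-identityʳ)
open import Data.Nat using (ℕ; zero; suc; _+_; _*_; _%_; _/_; _≤_; _<_; z≤n; s≤s; NonZero)
open import Data.Nat.DivMod using (m≡m%n+[m/n]*n; m%n<n; [m+kn]%n≡m%n)
open import Data.Nat.Induction using (<-rec)
open import Data.Nat.Properties using (+-comm; ≤-refl; ≤-trans; n≤1+n)
open import Data.Nat.Tactic.RingSolver using (solve)
open import Data.Product using (_×_; _,_; ∃)
open import Function using (_∘_)
open import Relation.Binary.PropositionalEquality
  using (_≡_; _≗_; refl; sym; trans; cong; cong₂; subst; module ≡-Reasoning)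
open ≡-Reasoning

module _ {A : Set} where

  holes : ℕ → Maybe A
  holes _ = nothing

  _◃_ : (ℕ → Maybe A) → (ℕ → Maybe A) → ℕ → Maybe A
  (u ◃ v) n = u n <∣> v (holesBefore u n)

  holesBefore-cong : {u v : ℕ → Maybe A} → u ≗ v → holesBefore u ≗ holesBefore v
  holesBefore-cong u≗v zero = refl
  holesBefore-cong {u} {v} u≗v (suc n) with u n | v n | u≗v n
  ... | just _  | just _  | refl = holesBefore-cong u≗v n
  ... | nothing | nothing | refl = cong suc (holesBefore-cong u≗v n)

  holesBefore-holes : holesBefore holes ≗ λ n → n
  holesBefore-holes zero    = refl
  holesBefore-holes (suc n) = cong suc (holesBefore-holes n)

  holesBefore-◃ : (u v : ℕ → Maybe A) → holesBefore (u ◃ v) ≗ holesBefore v ∘ holesBefore u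
  holesBefore-◃ u v zero = refl
  holesBefore-◃ u v (suc n) with u n
  ... | just _  = holesBefore-◃ u v n
  ... | nothing with v (holesBefore u n)
  ...   | just _  = holesBefore-◃ u v n
  ...   | nothing = cong suc (holesBefore-◃ u v n)

  holesBefore-suc-≤ : (u : ℕ → Maybe A) (n : ℕ) → holesBefore u (suc n) ≤ suc (holesBefore u n)
  holesBefore-suc-≤ u n with u n
  ... | just _  = n≤1+n _
  ... | nothing = ≤-refl

  holesBefore-< : {a : A} (u : ℕ → Maybe A) → u 0 ≡ just a → (n : ℕ) → holesBefore u (suc n) < suc n
  holesBefore-< u u0≡a zero with u 0 | u0≡a
  ... | just _ | refl = s≤s z≤n
  holesBefore-< u u0≡a (suc n) =
    s≤s (≤-trans (holesBefore-suc-≤ u (suc n)) (holesBefore-< u u0≡a n))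

  holesBefore-+ : (u : ℕ → Maybe A) (n m : ℕ) →
    holesBefore u (n + m) ≡ holesBefore (λ i → u (i + m)) n + holesBefore u m
  holesBefore-+ u zero    m = refl
  holesBefore-+ u (suc n) m with u (n + m)
  ... | just _  = holesBefore-+ u n m
  ... | nothing = cong suc (holesBefore-+ u n m)

  ◃-identityˡ : (v : ℕ → Maybe A) → holes ◃ v ≗ v
  ◃-identityˡ v n = cong v (holesBefore-holes n)

  ◃-identityʳ : (u : ℕ → Maybe A) → u ◃ holes ≗ u
  ◃-identityʳ u n = <∣>-identityʳ (u n)

  ◃-assoc : (u v z : ℕ → Maybe A) → (u ◃ v) ◃ z ≗ u ◃ (v ◃ z)
  ◃-assoc u v z n = begin
    (u n <∣> v m) <∣> z (holesBefore (u ◃ v) n)  ≡⟨ cong (λ i → (u n <∣> v m) <∣> z i) (holesBefore-◃ u v n) ⟩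
    (u n <∣> v m) <∣> z (holesBefore v m)        ≡⟨ <∣>-assoc (u n) (v m) _ ⟩
    u n <∣> (v m <∣> z (holesBefore v m))        ∎
    where m = holesBefore u n

  ◃-congˡ : {u u′ : ℕ → Maybe A} (v : ℕ → Maybe A) → u ≗ u′ → u ◃ v ≗ u′ ◃ v
  ◃-congˡ v u≗u′ n = cong₂ (λ c i → c <∣> v i) (u≗u′ n) (holesBefore-cong u≗u′ n)

  ◃-congʳ : (u : ℕ → Maybe A) {v v′ : ℕ → Maybe A} → v ≗ v′ → u ◃ v ≗ u ◃ v′
  ◃-congʳ u v≗v′ n = cong (u n <∣>_) (v≗v′ (holesBefore u n))

  module _ {ω : ℕ → Maybe A} {p : ℕ} (ω-periodic : ∀ k i → ω (i + k * p) ≡ ω i) where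

    holesBefore-shift : (k r : ℕ) → holesBefore ω (r + k * p) ≡ holesBefore ω r + holesBefore ω (k * p)
    holesBefore-shift k r = trans (holesBefore-+ ω r (k * p))
                                  (cong (_+ holesBefore ω (k * p)) (holesBefore-cong (ω-periodic k) r))

    holesBefore-* : (k : ℕ) → holesBefore ω (k * p) ≡ k * holesBefore ω p
    holesBefore-* zero    = refl
    holesBefore-* (suc k) = trans (holesBefore-shift k p) (cong (holesBefore ω p +_) (holesBefore-* k))

    holesBefore-periodic : (k r : ℕ) → holesBefore ω (r + k * p) ≡ holesBefore ω r + k * holesBefore ω p
    holesBefore-periodic k r = trans (holesBefore-shift k r) (cong (holesBefore ω r +_) (holesBefore-* k))

    ◃-fixedPoint-blockwise : .{{_ : NonZero p}} (x : ℕ → A) →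
      (∀ k r → r < p → just (x (r + k * p)) ≡ ω r <∣> just (x (holesBefore ω r + k * holesBefore ω p))) →
      ω ◃ (just ∘ x) ≗ just ∘ x
    ◃-fixedPoint-blockwise x blocks n =
      subst (λ m → (ω ◃ (just ∘ x)) m ≡ just (x m)) (sym (m≡m%n+[m/n]*n n p))
            (fixed-at (n / p) (n % p) (m%n<n n p))
      where
      fixed-at : ∀ k r → r < p → (ω ◃ (just ∘ x)) (r + k * p) ≡ just (x (r + k * p))
      fixed-at k r r<p = trans (cong₂ (λ c i → c <∣> just (x i)) (ω-periodic k r) (holesBefore-periodic k r))
                               (sym (blocks k r r<p))

  periodic-shift : (a : A) (rest : List (Maybe A)) (k i : ℕ) →
    periodic a rest (i + k * length (pattern-word a rest)) ≡ periodic a rest i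
  periodic-shift a rest k i = cong (lookup (pattern-word a rest))
    (fromℕ<-cong _ _ ([m+kn]%n≡m%n i k p) (m%n<n (i + k * p) p) (m%n<n i p))
    where p = length (pattern-word a rest)

  F≗◃ : (a : A) (rest : List (Maybe A)) (u : ℕ → Maybe A) → F a rest u ≗ u ◃ periodic a rest
  F≗◃ a rest u n with u n
  ... | just _  = refl
  ... | nothing = refl

  𝒯-suc : (a : A) (rest : List (Maybe A)) (i : ℕ) → 𝒯 a rest (suc i) ≗ periodic a rest ◃ 𝒯 a rest i
  𝒯-suc a rest zero n = begin
    𝒯 a rest 1 n          ≡⟨ F≗◃ a rest holes n ⟩
    (holes ◃ ω) n         ≡⟨ ◃-identityˡ ω n ⟩
    ω n                   ≡⟨ ◃-identityʳ ω n ⟨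
    (ω ◃ holes) n         ∎
    where ω = periodic a rest
  𝒯-suc a rest (suc i) n = begin
    𝒯 a rest (2 + i) n           ≡⟨ F≗◃ a rest _ n ⟩
    (𝒯 a rest (suc i) ◃ ω) n     ≡⟨ ◃-congˡ ω (𝒯-suc a rest i) n ⟩
    ((ω ◃ 𝒯 a rest i) ◃ ω) n     ≡⟨ ◃-assoc ω (𝒯 a rest i) ω n ⟩
    (ω ◃ (𝒯 a rest i ◃ ω)) n     ≡⟨ ◃-congʳ ω (F≗◃ a rest _) n ⟨
    (ω ◃ 𝒯 a rest (suc i)) n     ∎
    where ω = periodic a rest

  ◃-fixedPoint⇒IsToeplitzLimit : (a : A) (rest : List (Maybe A)) (x : ℕ → A) →
    periodic a rest ◃ (just ∘ x) ≗ just ∘ x → IsToeplitzLimit a rest x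
  ◃-fixedPoint⇒IsToeplitzLimit a rest x fixed = <-rec Stabilises stabilises
    where
    ω = periodic a rest

    Stabilises : ℕ → Set
    Stabilises n = ∃ λ i → ∀ j → i ≤ j → 𝒯 a rest j n ≡ just (x n)

    stabilises : ∀ n → (∀ {m} → m < n → Stabilises m) → Stabilises n
    stabilises n ih with ω n in ωn≡b
    ... | just b = 1 , λ { (suc j) _ → begin
      𝒯 a rest (suc j) n                      ≡⟨ 𝒯-suc a rest j n ⟩
      ω n <∣> 𝒯 a rest j (holesBefore ω n)    ≡⟨ cong (_<∣> 𝒯 a rest j (holesBefore ω n)) ωn≡b ⟩
      just b                                  ≡⟨ cong (_<∣> just (x (holesBefore ω n))) ωn≡b ⟨
      ω n <∣> just (x (holesBefore ω n))      ≡⟨ fixed n ⟩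
      just (x n)                              ∎ }
    -- Position 0 is never a hole, since ω 0 = just a.
    stabilises (suc n) ih | nothing with ih (holesBefore-< ω refl n)
    ... | i , stable = suc i , λ { (suc j) (s≤s i≤j) → begin
      𝒯 a rest (suc j) (suc n)     ≡⟨ 𝒯-suc a rest j (suc n) ⟩
      ω (suc n) <∣> 𝒯 a rest j m   ≡⟨ cong (ω (suc n) <∣>_) (stable j i≤j) ⟩
      ω (suc n) <∣> just (x m)     ≡⟨ fixed (suc n) ⟩
      just (x (suc n))             ∎ }
      where m = holesBefore ω (suc n)

≡not-trans : ∀ {a b c : Bool} → a ≡ not b → b ≡ not c → a ≡ c
≡not-trans {c = c} refl refl = not-involutive c

module _ {t : ℕ → Bool} where

  Δ-3n : IsT32 t → ∀ n → Δ t (3 * n) ≡ false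
  Δ-3n (_ , t-3n , t-3n+1 , _) n = begin
    t (1 + 3 * n) xor t (3 * n)   ≡⟨ cong (λ m → t m xor t (3 * n)) (+-comm 1 (3 * n)) ⟩
    t (3 * n + 1) xor t (3 * n)   ≡⟨ cong₂ _xor_ (t-3n+1 n) (t-3n n) ⟩
    t (2 * n) xor t (2 * n)       ≡⟨ xor-same (t (2 * n)) ⟩
    false                         ∎

  Δ-3n+1 : IsT32 t → ∀ n → Δ t (3 * n + 1) ≡ not (Δ t (2 * n))
  Δ-3n+1 (_ , _ , t-3n+1 , t-3n+2) n = begin
    t (suc (3 * n + 1)) xor t (3 * n + 1)  ≡⟨ cong (λ m → t m xor t (3 * n + 1)) (solve (n ∷ [])) ⟩
    t (3 * n + 2) xor t (3 * n + 1)        ≡⟨ cong₂ _xor_ (t-3n+2 n) (t-3n+1 n) ⟩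
    not (t (2 * n + 1)) xor t (2 * n)      ≡⟨ not-distribˡ-xor (t (2 * n + 1)) (t (2 * n)) ⟨
    not (t (2 * n + 1) xor t (2 * n))      ≡⟨ cong (λ m → not (t m xor t (2 * n))) (+-comm (2 * n) 1) ⟩
    not (Δ t (2 * n))                      ∎

  Δ-3n+2 : IsT32 t → ∀ n → Δ t (3 * n + 2) ≡ not (Δ t (2 * n + 1))
  Δ-3n+2 (_ , t-3n , _ , t-3n+2) n = begin
    t (suc (3 * n + 2)) xor t (3 * n + 2)        ≡⟨ cong (λ m → t m xor t (3 * n + 2)) (solve (n ∷ [])) ⟩
    t (3 * suc n) xor t (3 * n + 2)              ≡⟨ cong₂ _xor_ (t-3n (suc n)) (t-3n+2 n) ⟩
    t (2 * suc n) xor not (t (2 * n + 1))        ≡⟨ cong (λ m → t m xor not (t (2 * n + 1))) (solve (n ∷ [])) ⟩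
    t (suc (2 * n + 1)) xor not (t (2 * n + 1))  ≡⟨ not-distribʳ-xor (t (suc (2 * n + 1))) (t (2 * n + 1)) ⟨
    not (Δ t (2 * n + 1))                        ∎

  module _ (t32 : IsT32 t) where

    -- The recurrences along n = s + k * c, stated so that for numerals s and c both sides are
    -- again, definitionally, of the form r + k * p.
    Δ-3n′ : ∀ c s k → Δ t (3 * s + k * (3 * c)) ≡ false
    Δ-3n′ c s k = begin
      Δ t (3 * s + k * (3 * c))   ≡⟨ cong (Δ t) (solve (c ∷ s ∷ k ∷ [])) ⟩
      Δ t (3 * (s + k * c))       ≡⟨ Δ-3n t32 (s + k * c) ⟩
      false                       ∎

    Δ-3n+1′ : ∀ c s k → Δ t (3 * s + 1 + k * (3 * c)) ≡ not (Δ t (2 * s + k * (2 * c)))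
    Δ-3n+1′ c s k = begin
      Δ t (3 * s + 1 + k * (3 * c))      ≡⟨ cong (Δ t) (solve (c ∷ s ∷ k ∷ [])) ⟩
      Δ t (3 * (s + k * c) + 1)          ≡⟨ Δ-3n+1 t32 (s + k * c) ⟩
      not (Δ t (2 * (s + k * c)))        ≡⟨ cong (not ∘ Δ t) (solve (c ∷ s ∷ k ∷ [])) ⟩
      not (Δ t (2 * s + k * (2 * c)))    ∎

    Δ-3n+2′ : ∀ c s k → Δ t (3 * s + 2 + k * (3 * c)) ≡ not (Δ t (2 * s + 1 + k * (2 * c)))
    Δ-3n+2′ c s k = begin
      Δ t (3 * s + 2 + k * (3 * c))        ≡⟨ cong (Δ t) (solve (c ∷ s ∷ k ∷ [])) ⟩
      Δ t (3 * (s + k * c) + 2)            ≡⟨ Δ-3n+2 t32 (s + k * c) ⟩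
      not (Δ t (2 * (s + k * c) + 1))      ≡⟨ cong (not ∘ Δ t) (solve (c ∷ s ∷ k ∷ [])) ⟩
      not (Δ t (2 * s + 1 + k * (2 * c)))  ∎

    Δ-blocks : ∀ k r → r < 9 →
      just (Δ t (r + k * 9))
        ≡ periodic false w-rest r <∣> just (Δ t (holesBefore (periodic false w-rest) r + k * 4))
    Δ-blocks k 0 _ = cong just (Δ-3n′ 3 0 k)
    Δ-blocks k 1 _ = cong just (trans (Δ-3n+1′ 3 0 k) (cong not (Δ-3n′ 2 0 k)))
    Δ-blocks k 2 _ = cong just (≡not-trans (Δ-3n+2′ 3 0 k) (Δ-3n+1′ 2 0 k))
    Δ-blocks k 3 _ = cong just (Δ-3n′ 3 1 k)
    Δ-blocks k 4 _ = cong just (≡not-trans (Δ-3n+1′ 3 1 k) (Δ-3n+2′ 2 0 k))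
    Δ-blocks k 5 _ = cong just (trans (Δ-3n+2′ 3 1 k) (cong not (Δ-3n′ 2 1 k)))
    Δ-blocks k 6 _ = cong just (Δ-3n′ 3 2 k)
    Δ-blocks k 7 _ = cong just (≡not-trans (Δ-3n+1′ 3 2 k) (Δ-3n+1′ 2 1 k))
    Δ-blocks k 8 _ = cong just (≡not-trans (Δ-3n+2′ 3 2 k) (Δ-3n+2′ 2 1 k))
    Δ-blocks k (suc (suc (suc (suc (suc (suc (suc (suc (suc _))))))))) (s≤s (s≤s (s≤s (s≤s (s≤s (s≤s (s≤s (s≤s (s≤s ())))))))))

proposition11 : (t : ℕ → Bool) → IsT32 t →
    IsToeplitzLimit false w-rest (Δ t)
    × (length (pattern-word false w-rest) ≡ 9)
    × (countHoles (pattern-word false w-rest) ≡ 4)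
proposition11 t t32 =
  ◃-fixedPoint⇒IsToeplitzLimit false w-rest (Δ t)
    (◃-fixedPoint-blockwise (periodic-shift false w-rest) (Δ t) (Δ-blocks {t} t32))
  , refl , refl
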